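{- Let $\mathbf{C}:\mathcal{C}\to\mathcal{B}$ and $\mathbf{C}':\mathcal{C}'\to\mathcal{B}'$ be $h^=$-fibrations and let $(\phi,\Phi):\mathbf{C}\to\mathbf{C}'$ be a morphism of fibrations which is a fiberwise equivalence and such that $\phi:\mathcal{B}\to\mathcal{B}'$ preserves finite products. Then $(\phi,\Phi)$ is a morphism of $h^=$-fibrations.
   Context: Fibration terminology: for a functor $\mathbf{C}:\mathcal{C}\to\mathcal{B}$, objects/morphisms lie over their images; the fiber $\mathcal{C}^A$ has objects over $A$ and morphisms over $\mathrm{id}_A$; $q$ over $g$ is cartesian if every $r$ over $gf$ with the same codomain factors uniquely as $qp$ with $p$ over $f$; cocartesian is dual; a fibration has cartesian lifts with any given codomain. A morphism of fibrations $(\phi,\Phi)$ is a pair of functors $\phi:\mathcal{B}\to\mathcal{B}'$, $\Phi:\mathcal{C}\to\mathcal{C}'$ with $\mathbf{C}'\Phi=\phi\mathbf{C}$ and $\Phi$ preserving cartesian morphisms; it is a fiberwise equivalence if each induced functor $\mathcal{C}^A\to\mathcal{C}'^{\phi A}$ is an equivalence of categories. A $\prod$-diagram over $f:A\to B$ based on $P\in\mathcal{C}^A$: cartesian $c:f^*R\to R$ over $f$ with $\varepsilon:f^*R\to P$ in $\mathcal{C}^A$ such that for every cartesian $c':S\to Q$ over $f$ and $p:S\to P$ in $\mathcal{C}^A$ there is a unique $\tilde p:Q\to R$ in $\mathcal{C}^B$ with $\varepsilon u=p$, $u$ the unique morphism over $\mathrm{id}_A$ with $cu=\tilde pc'$.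 Stability: a product/coproduct/exponential diagram in a fiber is stable if pulling it back along cartesian lifts of any morphism yields a diagram of the same kind; for a pullback square $gh=kf$, a cocartesian morphism (resp. $\prod$-diagram) over $g$ is stable along $k$ if the morphism (resp. diagram) over $f$ induced between cartesian lifts over $h$ and $k$ is cocartesian (resp. a $\prod$-diagram). An $h^=$-fibration is a fibration whose fibers have stable finite products, coproducts and exponentials, whose base has finite products, with for every product projection $\pi_2:A\times B\to B$ and $P$ over $A\times B$ a cocartesian lift with domain $P$ and a $\prod$-diagram based on $P$, all such stable along all morphisms, and with, for every diagonal $\Delta_B$, a cocartesian lift with domain any terminal object of the fiber over $B$. A morphism of $h^=$-fibrations is a morphism of fibrations $(\phi,\Phi)$ such that the induced functors on fibers preserve finite products, finite coproducts and exponentials, $\Phi$ preserves $\prod$-diagrams and cocartesian morphisms over product projections, $\phi$ preserves finite products, and $\Phi$ preserves cocartesian lifts of diagonal morphisms with domain a terminal object. -}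

module Defs where

open import Level using (Level; _⊔_) renaming (suc to lsuc)
open import Relation.Binary.PropositionalEquality using (_≡_; refl)
open import Data.Unit.Polymorphic using (⊤)
open import Data.Product using (Σ; _×_; _,_; Σ-syntax)

private
  variable
    o ℓ o' ℓ' o₁ ℓ₁ o₂ ℓ₂ : Level

Unique : ∀ {a p} {A : Set a} → (A → Set p) → Set (a ⊔ p)
Unique {A = A} P = Σ[ x ∈ A ] (P x × (∀ y → P y → x ≡ y))

record Category (o ℓ : Level) : Set (lsuc (o ⊔ ℓ)) where
  infixr 9 _∘_
  field
    Obj : Set o
    Hom : Obj → Obj → Set ℓ
    id  : ∀ {A} → Hom A A
    _∘_ : ∀ {A B C} → Hom B C → Hom A B → Hom A C
    identityˡ : ∀ {A B} (f : Hom A B) → id ∘ f ≡ f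
    identityʳ : ∀ {A B} (f : Hom A B) → f ∘ id ≡ f
    assoc : ∀ {A B C D} (h : Hom C D) (g : Hom B C) (f : Hom A B) →
            (h ∘ g) ∘ f ≡ h ∘ (g ∘ f)

record Functor (C : Category o ℓ) (D : Category o' ℓ') : Set (o ⊔ ℓ ⊔ o' ⊔ ℓ') where
  private
    module C = Category C
    module D = Category D
  field
    F₀ : C.Obj → D.Obj
    F₁ : ∀ {A B} → C.Hom A B → D.Hom (F₀ A) (F₀ B)
    F-id : ∀ {A} → F₁ (C.id {A}) ≡ D.id
    F-∘ : ∀ {A B C'} (g : C.Hom B C') (f : C.Hom A B) → F₁ (g C.∘ f) ≡ F₁ g D.∘ F₁ f

module CatDefs (C : Category o ℓ) where
  open Category C

  IsTerminal : Obj → Set (o ⊔ ℓ)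
  IsTerminal T = ∀ X → Unique (λ (u : Hom X T) → ⊤ {ℓ})

  IsProduct : ∀ {P A B} → Hom P A → Hom P B → Set (o ⊔ ℓ)
  IsProduct {P} {A} {B} π₁ π₂ =
    ∀ {X} (x₁ : Hom X A) (x₂ : Hom X B) →
      Unique (λ (u : Hom X P) → (π₁ ∘ u ≡ x₁) × (π₂ ∘ u ≡ x₂))

  HasFiniteProducts : Set (o ⊔ ℓ)
  HasFiniteProducts =
    Σ[ T ∈ Obj ] IsTerminal T ×
    (∀ A B → Σ[ P ∈ Obj ] Σ[ π₁ ∈ Hom P A ] Σ[ π₂ ∈ Hom P B ] IsProduct π₁ π₂)

  IsPullback : ∀ {A B C' D} → Hom A B → Hom C' B → Hom D A → Hom D C' → Set (o ⊔ ℓ)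
  IsPullback {A} {B} {C'} {D} g k h f =
    (g ∘ h ≡ k ∘ f) ×
    (∀ {X} (x : Hom X A) (y : Hom X C') → g ∘ x ≡ k ∘ y →
       Unique (λ (u : Hom X D) → (h ∘ u ≡ x) × (f ∘ u ≡ y)))

cast : ∀ {o ℓ} {C : Category o ℓ} {A A' B B' : Category.Obj C} →
       A ≡ A' → B ≡ B' → Category.Hom C A B → Category.Hom C A' B'
cast refl refl f = f

module FibDefs {𝔹 : Category o₁ ℓ₁} {𝔼 : Category o₂ ℓ₂} (P : Functor 𝔼 𝔹) where
  private
    module B = Category 𝔹
    module E = Category 𝔼
    L = o₁ ⊔ ℓ₁ ⊔ o₂ ⊔ ℓ₂
  open Functor P
  open E
  open CatDefs 𝔹 using (IsProduct; IsPullback; HasFiniteProducts)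

  _over_ : ∀ {X Y A C} → Hom X Y → B.Hom A C → Set (o₁ ⊔ ℓ₁)
  _over_ {X} {Y} {A} {C} u g =
    Σ[ p ∈ F₀ X ≡ A ] Σ[ q ∈ F₀ Y ≡ C ] cast {C = 𝔹} p q (F₁ u) ≡ g

  Vert : ∀ (A : B.Obj) {X Y} → Hom X Y → Set (o₁ ⊔ ℓ₁)
  Vert A u = u over B.id {A}

  IsCartesian : ∀ {Y R} → Hom Y R → Set L
  IsCartesian {Y} {R} q =
    ∀ {Z A} (r : Hom Z R) (f : B.Hom A (F₀ Y)) → r over (F₁ q B.∘ f) →
      Unique (λ (p : Hom Z Y) → (p over f) × (q ∘ p ≡ r))

  IsCocartesian : ∀ {X Y} → Hom X Y → Set L
  IsCocartesian {X} {Y} q =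
    ∀ {Z A} (r : Hom X Z) (f : B.Hom (F₀ Y) A) → r over (f B.∘ F₁ q) →
      Unique (λ (p : Hom Y Z) → (p over f) × (p ∘ q ≡ r))

  CartOver : ∀ {X R A C} → B.Hom A C → Hom X R → Set L
  CartOver g c = (c over g) × IsCartesian c

  IsFibration : Set L
  IsFibration = ∀ {A} (R : Obj) (g : B.Hom A (F₀ R)) →
    Σ[ X ∈ Obj ] Σ[ c ∈ Hom X R ] CartOver g c

  IsTerminalIn : B.Obj → Obj → Set L
  IsTerminalIn A T = (F₀ T ≡ A) ×
    (∀ X → F₀ X ≡ A → Unique (λ (u : Hom X T) → Vert A u))

  IsInitialIn : B.Obj → Obj → Set L
  IsInitialIn A I = (F₀ I ≡ A) ×
    (∀ X → F₀ X ≡ A → Unique (λ (u : Hom I X) → Vert A u))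

  IsProductIn : ∀ (A : B.Obj) {Q Q₁ Q₂} → Hom Q Q₁ → Hom Q Q₂ → Set L
  IsProductIn A {Q} {Q₁} {Q₂} π₁ π₂ = Vert A π₁ × Vert A π₂ ×
    (∀ {X} (x₁ : Hom X Q₁) (x₂ : Hom X Q₂) → Vert A x₁ → Vert A x₂ →
      Unique (λ (u : Hom X Q) → Vert A u × (π₁ ∘ u ≡ x₁) × (π₂ ∘ u ≡ x₂)))

  IsCoproductIn : ∀ (A : B.Obj) {Q Q₁ Q₂} → Hom Q₁ Q → Hom Q₂ Q → Set L
  IsCoproductIn A {Q} {Q₁} {Q₂} ι₁ ι₂ = Vert A ι₁ × Vert A ι₂ ×
    (∀ {X} (x₁ : Hom Q₁ X) (x₂ : Hom Q₂ X) → Vert A x₁ → Vert A x₂ →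
      Unique (λ (u : Hom Q X) → Vert A u × (u ∘ ι₁ ≡ x₁) × (u ∘ ι₂ ≡ x₂)))

  -- exponential diagram: product  (π₁ : EY → Ex, π₂ : EY → Y)  and  ev : EY → Z,
  -- universal among all product diagrams (p₁ : XY → X, p₂ : XY → Y) and
  -- maps f : XY → Z; the condition on g says  ev ∘ (g × id) = f , where
  -- g × id is the (unique) h with π₁ ∘ h = g ∘ p₁ and π₂ ∘ h = p₂.
  IsExponentialIn : ∀ (A : B.Obj) {Ex EY Y Z} →
                    Hom EY Ex → Hom EY Y → Hom EY Z → Set L
  IsExponentialIn A {Ex} {EY} {Y} {Z} π₁ π₂ ev =
    IsProductIn A π₁ π₂ × Vert A ev ×
    (∀ {X XY} (p₁ : Hom XY X) (p₂ : Hom XY Y) → IsProductIn A p₁ p₂ →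
      (f : Hom XY Z) → Vert A f →
      Unique (λ (g : Hom X Ex) → Vert A g ×
        (∀ (h : Hom XY EY) → Vert A h → π₁ ∘ h ≡ g ∘ p₁ → π₂ ∘ h ≡ p₂ →
           ev ∘ h ≡ f)))

  StableTerminal : B.Obj → Obj → Set L
  StableTerminal A T = ∀ {A'} (f : B.Hom A' A) {X} (c : Hom X T) →
    CartOver f c → IsTerminalIn A' X

  StableInitial : B.Obj → Obj → Set L
  StableInitial A I = ∀ {A'} (f : B.Hom A' A) {X} (c : Hom X I) →
    CartOver f c → IsInitialIn A' X

  StableProduct : ∀ (A : B.Obj) {Q Q₁ Q₂} → Hom Q Q₁ → Hom Q Q₂ → Set L
  StableProduct A {Q} {Q₁} {Q₂} π₁ π₂ =
    ∀ {A'} (f : B.Hom A' A) {X X₁ X₂}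
      (c : Hom X Q) (c₁ : Hom X₁ Q₁) (c₂ : Hom X₂ Q₂) →
      CartOver f c → CartOver f c₁ → CartOver f c₂ →
      (u₁ : Hom X X₁) (u₂ : Hom X X₂) → Vert A' u₁ → Vert A' u₂ →
      c₁ ∘ u₁ ≡ π₁ ∘ c → c₂ ∘ u₂ ≡ π₂ ∘ c →
      IsProductIn A' u₁ u₂

  StableCoproduct : ∀ (A : B.Obj) {Q Q₁ Q₂} → Hom Q₁ Q → Hom Q₂ Q → Set L
  StableCoproduct A {Q} {Q₁} {Q₂} ι₁ ι₂ =
    ∀ {A'} (f : B.Hom A' A) {X X₁ X₂}
      (c : Hom X Q) (c₁ : Hom X₁ Q₁) (c₂ : Hom X₂ Q₂) →
      CartOver f c → CartOver f c₁ → CartOver f c₂ →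
      (u₁ : Hom X₁ X) (u₂ : Hom X₂ X) → Vert A' u₁ → Vert A' u₂ →
      c ∘ u₁ ≡ ι₁ ∘ c₁ → c ∘ u₂ ≡ ι₂ ∘ c₂ →
      IsCoproductIn A' u₁ u₂

  StableExponential : ∀ (A : B.Obj) {Ex EY Y Z} →
                      Hom EY Ex → Hom EY Y → Hom EY Z → Set L
  StableExponential A {Ex} {EY} {Y} {Z} π₁ π₂ ev =
    ∀ {A'} (f : B.Hom A' A) {Ex' EY' Y' Z'}
      (cE : Hom Ex' Ex) (cEY : Hom EY' EY) (cY : Hom Y' Y) (cZ : Hom Z' Z) →
      CartOver f cE → CartOver f cEY → CartOver f cY → CartOver f cZ →
      (u₁ : Hom EY' Ex') (u₂ : Hom EY' Y') (e : Hom EY' Z') →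
      Vert A' u₁ → Vert A' u₂ → Vert A' e →
      cE ∘ u₁ ≡ π₁ ∘ cEY → cY ∘ u₂ ≡ π₂ ∘ cEY → cZ ∘ e ≡ ev ∘ cEY →
      IsExponentialIn A' u₁ u₂ e

  record StableFiberStructure : Set L where
    field
      terminal : ∀ A → Σ[ T ∈ Obj ] IsTerminalIn A T
      products : ∀ A Q₁ Q₂ → F₀ Q₁ ≡ A → F₀ Q₂ ≡ A →
        Σ[ Q ∈ Obj ] Σ[ π₁ ∈ Hom Q Q₁ ] Σ[ π₂ ∈ Hom Q Q₂ ] IsProductIn A π₁ π₂
      initial : ∀ A → Σ[ I ∈ Obj ] IsInitialIn A I
      coproducts : ∀ A Q₁ Q₂ → F₀ Q₁ ≡ A → F₀ Q₂ ≡ A →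
        Σ[ Q ∈ Obj ] Σ[ ι₁ ∈ Hom Q₁ Q ] Σ[ ι₂ ∈ Hom Q₂ Q ] IsCoproductIn A ι₁ ι₂
      exponentials : ∀ A Y Z → F₀ Y ≡ A → F₀ Z ≡ A →
        Σ[ Ex ∈ Obj ] Σ[ EY ∈ Obj ] Σ[ π₁ ∈ Hom EY Ex ] Σ[ π₂ ∈ Hom EY Y ]
        Σ[ ev ∈ Hom EY Z ] IsExponentialIn A π₁ π₂ ev
      terminal-stable : ∀ A T → IsTerminalIn A T → StableTerminal A T
      product-stable : ∀ A {Q Q₁ Q₂} (π₁ : Hom Q Q₁) (π₂ : Hom Q Q₂) →
        IsProductIn A π₁ π₂ → StableProduct A π₁ π₂
      initial-stable : ∀ A I → IsInitialIn A I → StableInitial A I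
      coproduct-stable : ∀ A {Q Q₁ Q₂} (ι₁ : Hom Q₁ Q) (ι₂ : Hom Q₂ Q) →
        IsCoproductIn A ι₁ ι₂ → StableCoproduct A ι₁ ι₂
      exponential-stable : ∀ A {Ex EY Y Z}
        (π₁ : Hom EY Ex) (π₂ : Hom EY Y) (ev : Hom EY Z) →
        IsExponentialIn A π₁ π₂ ev → StableExponential A π₁ π₂ ev

  IsPiDiagram : ∀ {A C} (f : B.Hom A C) {X R Q} → Hom X R → Hom X Q → Set L
  IsPiDiagram {A} {C} f {X} {R} {Q} c ε =
    CartOver f c × Vert A ε ×
    (∀ {S Q'} (c' : Hom S Q') → CartOver f c' → (p : Hom S Q) → Vert A p →
      Unique (λ (p̃ : Hom Q' R) → Vert C p̃ ×
        (∀ (u : Hom S X) → Vert A u → c ∘ u ≡ p̃ ∘ c' → ε ∘ u ≡ p)))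

  CocartStable : ∀ {A Bo C D} (g : B.Hom A Bo) (k : B.Hom C Bo)
                   (h : B.Hom D A) (f : B.Hom D C) {X Y} → Hom X Y → Set L
  CocartStable {A} {Bo} {C} {D} g k h f {X} {Y} q =
    ∀ {X' Y'} (ch : Hom X' X) (ck : Hom Y' Y) → CartOver h ch → CartOver k ck →
      (m : Hom X' Y') → m over f → ck ∘ m ≡ q ∘ ch → IsCocartesian m

  PiStable : ∀ {A Bo C D} (g : B.Hom A Bo) (k : B.Hom C Bo)
               (h : B.Hom D A) (f : B.Hom D C) {X R Q} →
               Hom X R → Hom X Q → Set L
  PiStable {A} {Bo} {C} {D} g k h f {X} {R} {Q} c ε =
    ∀ {R' Z Q'} (cR : Hom R' R) (c₁ : Hom Z X) (cQ : Hom Q' Q) →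
      CartOver k cR → CartOver h c₁ → CartOver h cQ →
      (c' : Hom Z R') → c' over f → cR ∘ c' ≡ c ∘ c₁ →
      (ε' : Hom Z Q') → Vert D ε' → cQ ∘ ε' ≡ ε ∘ c₁ →
      IsPiDiagram f c' ε'

  record IsHEqFibration : Set L where
    field
      fibration : IsFibration
      fibers : StableFiberStructure
      base-products : HasFiniteProducts
      cocart-proj : ∀ {A Bo Xb} (π₁ : B.Hom Xb A) (π₂ : B.Hom Xb Bo) →
        IsProduct π₁ π₂ → ∀ Q → F₀ Q ≡ Xb →
        Σ[ Q' ∈ Obj ] Σ[ q ∈ Hom Q Q' ] (q over π₂) × IsCocartesian q
      pi-proj : ∀ {A Bo Xb} (π₁ : B.Hom Xb A) (π₂ : B.Hom Xb Bo) →
        IsProduct π₁ π₂ → ∀ Q → F₀ Q ≡ Xb →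
        Σ[ X ∈ Obj ] Σ[ R ∈ Obj ] Σ[ c ∈ Hom X R ] Σ[ ε ∈ Hom X Q ]
          IsPiDiagram π₂ c ε
      cocart-proj-stable : ∀ {A Bo Xb} (π₁ : B.Hom Xb A) (π₂ : B.Hom Xb Bo) →
        IsProduct π₁ π₂ → ∀ {Q Q'} (q : Hom Q Q') → q over π₂ → IsCocartesian q →
        ∀ {C D} (k : B.Hom C Bo) (h : B.Hom D Xb) (f : B.Hom D C) →
        IsPullback π₂ k h f → CocartStable π₂ k h f q
      pi-proj-stable : ∀ {A Bo Xb} (π₁ : B.Hom Xb A) (π₂ : B.Hom Xb Bo) →
        IsProduct π₁ π₂ → ∀ {X R Q} (c : Hom X R) (ε : Hom X Q) →
        IsPiDiagram π₂ c ε →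
        ∀ {C D} (k : B.Hom C Bo) (h : B.Hom D Xb) (f : B.Hom D C) →
        IsPullback π₂ k h f → PiStable π₂ k h f c ε
      cocart-diag : ∀ {Bo Xb} (π₁ π₂ : B.Hom Xb Bo) → IsProduct π₁ π₂ →
        (Δ : B.Hom Bo Xb) → π₁ B.∘ Δ ≡ B.id → π₂ B.∘ Δ ≡ B.id →
        ∀ T → IsTerminalIn Bo T →
        Σ[ Q ∈ Obj ] Σ[ q ∈ Hom T Q ] (q over Δ) × IsCocartesian q

module MorDefs {ob ℓb oe ℓe ob' ℓb' oe' ℓe' : Level}
  {𝔹 : Category ob ℓb} {𝔼 : Category oe ℓe} (P : Functor 𝔼 𝔹)
  {𝔹' : Category ob' ℓb'} {𝔼' : Category oe' ℓe'} (P' : Functor 𝔼' 𝔹')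
  (φ : Functor 𝔹 𝔹') (Φ : Functor 𝔼 𝔼') where

  private
    module B = Category 𝔹
    module E = Category 𝔼
    module B' = Category 𝔹'
    module E' = Category 𝔼'
    module P = Functor P
    module P' = Functor P'
    module φ = Functor φ
    module Φ = Functor Φ
    module F = FibDefs P
    module F' = FibDefs P'
    module CB = CatDefs 𝔹
    module CB' = CatDefs 𝔹'
    L = ob ⊔ ℓb ⊔ oe ⊔ ℓe ⊔ ob' ⊔ ℓb' ⊔ oe' ⊔ ℓe'

  record IsFibrationMorphism : Set L where
    field
      comm₀ : ∀ X → P'.F₀ (Φ.F₀ X) ≡ φ.F₀ (P.F₀ X)
      comm₁ : ∀ {X Y} (u : E.Hom X Y) →
        cast {C = 𝔹'} (comm₀ X) (comm₀ Y) (P'.F₁ (Φ.F₁ u)) ≡ φ.F₁ (P.F₁ u)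
      pres-cartesian : ∀ {X Y} (q : E.Hom X Y) →
        F.IsCartesian q → F'.IsCartesian (Φ.F₁ q)

  -- each induced functor  𝒞^A → 𝒞'^(φ A)  is an equivalence:
  -- full, faithful and (split) essentially surjective
  IsFiberwiseEquivalence : Set L
  IsFiberwiseEquivalence = ∀ (A : B.Obj) →
    (∀ {X Y} → P.F₀ X ≡ A → P.F₀ Y ≡ A →
       (g : E'.Hom (Φ.F₀ X) (Φ.F₀ Y)) → F'.Vert (φ.F₀ A) g →
       Σ[ u ∈ E.Hom X Y ] F.Vert A u × (Φ.F₁ u ≡ g)) ×
    (∀ {X Y} (u v : E.Hom X Y) → F.Vert A u → F.Vert A v →
       Φ.F₁ u ≡ Φ.F₁ v → u ≡ v) ×
    (∀ (Y' : E'.Obj) → P'.F₀ Y' ≡ φ.F₀ A →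
       Σ[ X ∈ E.Obj ] (P.F₀ X ≡ A) ×
       Σ[ i ∈ E'.Hom (Φ.F₀ X) Y' ] Σ[ j ∈ E'.Hom Y' (Φ.F₀ X) ]
         F'.Vert (φ.F₀ A) i × F'.Vert (φ.F₀ A) j ×
         (i E'.∘ j ≡ E'.id) × (j E'.∘ i ≡ E'.id))

  PreservesFiniteProducts : Set (ob ⊔ ℓb ⊔ ob' ⊔ ℓb')
  PreservesFiniteProducts =
    (∀ T → CB.IsTerminal T → CB'.IsTerminal (φ.F₀ T)) ×
    (∀ {Xb A Bo} (π₁ : B.Hom Xb A) (π₂ : B.Hom Xb Bo) →
       CB.IsProduct π₁ π₂ → CB'.IsProduct (φ.F₁ π₁) (φ.F₁ π₂))

  record IsHEqMorphism : Set L where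
    field
      fibration-morphism : IsFibrationMorphism
      pres-terminal : ∀ A T → F.IsTerminalIn A T →
        F'.IsTerminalIn (φ.F₀ A) (Φ.F₀ T)
      pres-product : ∀ A {Q Q₁ Q₂} (π₁ : E.Hom Q Q₁) (π₂ : E.Hom Q Q₂) →
        F.IsProductIn A π₁ π₂ → F'.IsProductIn (φ.F₀ A) (Φ.F₁ π₁) (Φ.F₁ π₂)
      pres-initial : ∀ A I → F.IsInitialIn A I →
        F'.IsInitialIn (φ.F₀ A) (Φ.F₀ I)
      pres-coproduct : ∀ A {Q Q₁ Q₂} (ι₁ : E.Hom Q₁ Q) (ι₂ : E.Hom Q₂ Q) →
        F.IsCoproductIn A ι₁ ι₂ → F'.IsCoproductIn (φ.F₀ A) (Φ.F₁ ι₁) (Φ.F₁ ι₂)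
      pres-exponential : ∀ A {Ex EY Y Z}
        (π₁ : E.Hom EY Ex) (π₂ : E.Hom EY Y) (ev : E.Hom EY Z) →
        F.IsExponentialIn A π₁ π₂ ev →
        F'.IsExponentialIn (φ.F₀ A) (Φ.F₁ π₁) (Φ.F₁ π₂) (Φ.F₁ ev)
      pres-pi : ∀ {A Bo Xb} (π₁ : B.Hom Xb A) (π₂ : B.Hom Xb Bo) →
        CB.IsProduct π₁ π₂ → ∀ {X R Q} (c : E.Hom X R) (ε : E.Hom X Q) →
        F.IsPiDiagram π₂ c ε → F'.IsPiDiagram (φ.F₁ π₂) (Φ.F₁ c) (Φ.F₁ ε)
      pres-cocart-proj : ∀ {A Bo Xb} (π₁ : B.Hom Xb A) (π₂ : B.Hom Xb Bo) →
        CB.IsProduct π₁ π₂ → ∀ {Q Q'} (q : E.Hom Q Q') →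
        F._over_ q π₂ → F.IsCocartesian q → F'.IsCocartesian (Φ.F₁ q)
      pres-base-products : PreservesFiniteProducts
      pres-cocart-diag : ∀ {Bo Xb} (π₁ π₂ : B.Hom Xb Bo) → CB.IsProduct π₁ π₂ →
        (Δ : B.Hom Bo Xb) → π₁ B.∘ Δ ≡ B.id → π₂ B.∘ Δ ≡ B.id →
        ∀ {T Q} (q : E.Hom T Q) → F.IsTerminalIn Bo T →
        F._over_ q Δ → F.IsCocartesian q → F'.IsCocartesian (Φ.F₁ q)

-- A fiberwise equivalence Φ is full and faithful on vertical maps, hence also on maps over
-- any base morphism g: factor through a cartesian lift of g, which Φ preserves. Every object
-- X' of the fibre over φ A is vertically isomorphic to some Φ X, and composing with this
-- isomorphism identifies vertical maps out of (into) X' with images of maps out of (into) X.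
-- Each piece of h^=-structure is a universal property: a unique vertical mediating map for
-- every test datum. Replacing the test data by images (a product or a cartesian lift in the
-- test datum is replaced by the corresponding one in 𝒞, unique up to vertical isomorphism)
-- transports the universal property in 𝒞 to the one in 𝒞'. For cocartesian morphisms it
-- suffices, in a fibration, to be universal among maps over the same base morphism, which
-- reduces them to the vertical case as well.

module Submission where

open import Level using (Level; _⊔_)
open import Defs
open import Relation.Binary.PropositionalEquality
open import Data.Product using (_×_; _,_; proj₁; proj₂; Σ-syntax)

Unique-≡ : ∀ {a p} {A : Set a} {P : A → Set p} → Unique P → ∀ {x y} → P x → P y → x ≡ y
Unique-≡ (_ , _ , unique) px py = trans (sym (unique _ px)) (unique _ py)

Unique-map : ∀ {a b p q} {A : Set a} {B : Set b} {P : A → Set p} {Q : B → Set q}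
  (f : A → B) (g : ∀ y → Q y → A) →
  (∀ {x} → P x → Q (f x)) → (∀ {y} (qy : Q y) → P (g y qy)) →
  (∀ {y} (qy : Q y) → f (g y qy) ≡ y) →
  Unique P → Unique Q
Unique-map f g f-pres g-pres f∘g (x , px , unique) =
  f x , f-pres px , λ y qy → trans (cong f (unique _ (g-pres qy))) (f∘g qy)

module CategoryProperties {o ℓ} (𝒞 : Category o ℓ) where
  open Category 𝒞

  cancelʳ : ∀ {X Y Z} {h : Hom Y Z} {i : Hom X Y} {j : Hom Y X} →
            i ∘ j ≡ id → (h ∘ i) ∘ j ≡ h
  cancelʳ {h = h} {i} {j} ij = trans (assoc h i j) (trans (cong (h ∘_) ij) (identityʳ h))

  cancelˡ : ∀ {X Y Z} {h : Hom Z Y} {i : Hom Y X} {j : Hom X Y} →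
            j ∘ i ≡ id → j ∘ (i ∘ h) ≡ h
  cancelˡ {h = h} {i} {j} ji = trans (sym (assoc j i h)) (trans (cong (_∘ h) ji) (identityˡ h))

  pullˡ : ∀ {W X Y Z} {a : Hom Y Z} {b : Hom X Y} {c : Hom X Z} {f : Hom W X} →
          a ∘ b ≡ c → a ∘ (b ∘ f) ≡ c ∘ f
  pullˡ {a = a} {b} {f = f} e = trans (sym (assoc a b f)) (cong (_∘ f) e)

  pullʳ : ∀ {W X Y Z} {a : Hom Y Z} {b : Hom X Y} {c : Hom W Y} {f : Hom W X} →
          b ∘ f ≡ c → (a ∘ b) ∘ f ≡ a ∘ c
  pullʳ {a = a} {b} {f = f} e = trans (assoc a b f) (cong (a ∘_) e)

module Over {o₁ ℓ₁ o₂ ℓ₂} {𝔹 : Category o₁ ℓ₁} {𝔼 : Category o₂ ℓ₂} (P : Functor 𝔼 𝔹) where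
  open FibDefs P
  open Functor P
  open Category 𝔼
  open CategoryProperties 𝔼
  private
    module B = Category 𝔹

  over-self : ∀ {X Y} (u : Hom X Y) → u over F₁ u
  over-self u = refl , refl , refl

  over-∘ : ∀ {X Y Z A C D} {u : Hom X Y} {v : Hom Y Z} {g : B.Hom A C} {h : B.Hom C D} →
           u over g → v over h → (v ∘ u) over (h B.∘ g)
  over-∘ {u = u} {v} (refl , refl , refl) (refl , refl , refl) = refl , refl , F-∘ v u

  over-resp : ∀ {X Y A C} {u : Hom X Y} {g g' : B.Hom A C} → u over g → g ≡ g' → u over g'
  over-resp o refl = o

  over-dom : ∀ {X Y A C} {u : Hom X Y} {g : B.Hom A C} → u over g → F₀ X ≡ A
  over-dom = proj₁

  over-cod : ∀ {X Y A C} {u : Hom X Y} {g : B.Hom A C} → u over g → F₀ Y ≡ C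
  over-cod o = proj₁ (proj₂ o)

  vert-id : ∀ {X A} → F₀ X ≡ A → Vert A (id {X})
  vert-id refl = refl , refl , F-id

  vert-∘ : ∀ {X Y Z A} {u : Hom X Y} {v : Hom Y Z} → Vert A u → Vert A v → Vert A (v ∘ u)
  vert-∘ vu vv = over-resp (over-∘ vu vv) (B.identityˡ _)

  over∘vert : ∀ {X Y Z A C} {u : Hom X Y} {v : Hom Y Z} {g : B.Hom A C} →
              v over g → Vert A u → (v ∘ u) over g
  over∘vert vo vu = over-resp (over-∘ vu vo) (B.identityʳ _)

  vert∘over : ∀ {X Y Z A C} {u : Hom X Y} {v : Hom Y Z} {g : B.Hom A C} →
              Vert C v → u over g → (v ∘ u) over g
  vert∘over vv uo = over-resp (over-∘ uo vv) (B.identityˡ _)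

  cartesian-lift : IsFibration → ∀ {A C} (g : B.Hom A C) R → F₀ R ≡ C →
                   Σ[ X ∈ Obj ] Σ[ c ∈ Hom X R ] CartOver g c
  cartesian-lift fib g R refl = fib R g

  cartesian-factor : ∀ {X R A C} {g : B.Hom A C} {c : Hom X R} → CartOver g c →
    ∀ {Z D} (r : Hom Z R) (f : B.Hom D A) → r over (g B.∘ f) →
    Unique (λ (p : Hom Z X) → (p over f) × (c ∘ p ≡ r))
  cartesian-factor ((refl , refl , refl) , cartesian) = cartesian

  cartesian-cancel : ∀ {X R A C} {g : B.Hom A C} {c : Hom X R} → CartOver g c →
    ∀ {Z D} {f : B.Hom D A} {u v : Hom Z X} → u over f → v over f →
    c ∘ u ≡ c ∘ v → u ≡ v
  cartesian-cancel cc {f = f} {u} {v} uo vo e =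
    Unique-≡ (cartesian-factor cc (_ ∘ u) f (over-∘ uo (proj₁ cc))) (uo , refl) (vo , sym e)

  record VerticalIso (A : B.Obj) (X Y : Obj) : Set (o₁ ⊔ ℓ₁ ⊔ ℓ₂) where
    field
      to : Hom X Y
      from : Hom Y X
      to-vert : Vert A to
      from-vert : Vert A from
      isoˡ : from ∘ to ≡ id
      isoʳ : to ∘ from ≡ id

  cartesian-lift-vertical : ∀ {X Y W Z A C} {g : B.Hom A C} {c : Hom X Y} {d : Hom W Z} →
    CartOver g d → c over g → (k : Hom Y Z) → Vert C k →
    Σ[ m ∈ Hom X W ] Vert A m × (d ∘ m ≡ k ∘ c)
  cartesian-lift-vertical dc co k vk =
    let (m , (vm , dm) , _) = cartesian-factor dc (k ∘ _) B.id
                                (over-resp (vert∘over vk co) (sym (B.identityʳ _)))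
    in m , vm , dm

  open VerticalIso

  cartesian-domains-iso : ∀ {X Y W Z A C} {g : B.Hom A C} {c : Hom X Y} {d : Hom W Z} →
    CartOver g c → CartOver g d → (ι : VerticalIso C Z Y) →
    Σ[ κ ∈ VerticalIso A W X ] (d ∘ from κ ≡ from ι ∘ c)
  cartesian-domains-iso {c = c} {d} cc dc ι
    with cartesian-lift-vertical dc (proj₁ cc) (from ι) (from-vert ι)
       | cartesian-lift-vertical cc (proj₁ dc) (to ι) (to-vert ι)
  ... | m , vm , dm | n , vn , cn =
    record { to = n ; from = m ; to-vert = vn ; from-vert = vm ; isoˡ = mn ; isoʳ = nm } , dm
    where
    open ≡-Reasoning
    mn : m ∘ n ≡ id
    mn = cartesian-cancel dc (vert-∘ vn vm) (vert-id (over-dom (proj₁ dc))) (begin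
      d ∘ (m ∘ n)          ≡⟨ pullˡ dm ⟩
      (from ι ∘ c) ∘ n     ≡⟨ pullʳ cn ⟩
      from ι ∘ (to ι ∘ d)  ≡⟨ cancelˡ (isoˡ ι) ⟩
      d                    ≡˘⟨ identityʳ d ⟩
      d ∘ id               ∎)
    nm : n ∘ m ≡ id
    nm = cartesian-cancel cc (vert-∘ vm vn) (vert-id (over-dom (proj₁ cc))) (begin
      c ∘ (n ∘ m)          ≡⟨ pullˡ cn ⟩
      (to ι ∘ d) ∘ m       ≡⟨ pullʳ dm ⟩
      to ι ∘ (from ι ∘ c)  ≡⟨ cancelˡ (isoʳ ι) ⟩
      c                    ≡˘⟨ identityʳ c ⟩
      c ∘ id               ∎)

  product-apexes-iso : ∀ {A XY X₁ XZ X₂ Y}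
    {p₁ : Hom XY X₁} {p₂ : Hom XY Y} {q₁ : Hom XZ X₂} {q₂ : Hom XZ Y} →
    IsProductIn A p₁ p₂ → IsProductIn A q₁ q₂ → (ι : VerticalIso A X₂ X₁) →
    Σ[ κ ∈ VerticalIso A XZ XY ] (q₁ ∘ from κ ≡ from ι ∘ p₁) × (q₂ ∘ from κ ≡ p₂)
  product-apexes-iso {p₁ = p₁} {p₂} {q₁} {q₂} (vp₁ , vp₂ , p-univ) (vq₁ , vq₂ , q-univ) ι
    with q-univ (from ι ∘ p₁) p₂ (vert-∘ vp₁ (from-vert ι)) vp₂
       | p-univ (to ι ∘ q₁) q₂ (vert-∘ vq₁ (to-vert ι)) vq₂
  ... | k , (vk , q₁k , q₂k) , _ | l , (vl , p₁l , p₂l) , _ =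
    record { to = l ; from = k ; to-vert = vl ; from-vert = vk ; isoˡ = kl ; isoʳ = lk } ,
    q₁k , q₂k
    where
    kl : k ∘ l ≡ id
    kl = Unique-≡ (q-univ q₁ q₂ vq₁ vq₂)
           (vert-∘ vl vk ,
            trans (pullˡ q₁k) (trans (pullʳ p₁l) (cancelˡ (isoˡ ι))) ,
            trans (pullˡ q₂k) p₂l)
           (vert-id (over-dom vq₁) , identityʳ q₁ , identityʳ q₂)
    lk : l ∘ k ≡ id
    lk = Unique-≡ (p-univ p₁ p₂ vp₁ vp₂)
           (vert-∘ vk vl ,
            trans (pullˡ p₁l) (trans (pullʳ q₁k) (cancelˡ (isoʳ ι))) ,
            trans (pullˡ p₂l) q₂k)
           (vert-id (over-dom vp₁) , identityʳ p₁ , identityʳ p₂)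

  cocartesian-if-vertically-universal : IsFibration →
    ∀ {X Y A C} {g : B.Hom A C} {q : Hom X Y} → q over g →
    (∀ {Z} (r : Hom X Z) → r over g → Unique (λ (p : Hom Y Z) → Vert C p × (p ∘ q ≡ r))) →
    IsCocartesian q
  cocartesian-if-vertically-universal fib {q = q} (refl , refl , refl) universal {Z} r f ro
    with cartesian-lift fib f Z (over-cod ro)
  ... | W , c , cc with cartesian-factor cc r (F₁ q) ro
  ... | r' , (r'o , cr') , _ with universal r' r'o
  ... | p₀ , (vp₀ , p₀q) , p₀-unique =
    c ∘ p₀ , (over∘vert (proj₁ cc) vp₀ , trans (pullʳ p₀q) cr') , unique
    where
    unique : ∀ p → (p over f) × (p ∘ q ≡ r) → c ∘ p₀ ≡ p
    unique p (po , pq) =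
      let (p' , (vp' , cp') , _) = cartesian-factor cc p B.id (over-resp po (sym (B.identityʳ f)))
          p'q≡r' = cartesian-cancel cc (over-resp (over-∘ (over-self q) vp') (B.identityˡ _)) r'o
                     (trans (sym (assoc c p' q)) (trans (cong (_∘ q) cp') (trans pq (sym cr'))))
      in trans (cong (c ∘_) (p₀-unique p' (vp' , p'q≡r'))) cp'

module FiberwiseEquivalence {ob ℓb oe ℓe ob' ℓb' oe' ℓe' : Level}
    {𝔹 : Category ob ℓb} {𝔼 : Category oe ℓe} (P : Functor 𝔼 𝔹)
    {𝔹' : Category ob' ℓb'} {𝔼' : Category oe' ℓe'} (P' : Functor 𝔼' 𝔹')
    (φ : Functor 𝔹 𝔹') (Φ : Functor 𝔼 𝔼')
    (fibration : FibDefs.IsFibration P)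
    (morphism : MorDefs.IsFibrationMorphism P P' φ Φ)
    (equivalence : MorDefs.IsFiberwiseEquivalence P P' φ Φ) where

  private
    module B = Category 𝔹
    module E = Category 𝔼
    module B' = Category 𝔹'
    module P = Functor P
    module P' = Functor P'
    module φ = Functor φ
    module Φ = Functor Φ
    module F = FibDefs P
    module F' = FibDefs P'
    module O = Over P
    module O' = Over P'
  open Category 𝔼'
  open CategoryProperties 𝔼'
  open MorDefs.IsFibrationMorphism morphism
  open O'.VerticalIso

  Φ-obj : ∀ {X A} → P.F₀ X ≡ A → P'.F₀ (Φ.F₀ X) ≡ φ.F₀ A
  Φ-obj {X} pX = trans (comm₀ X) (cong φ.F₀ pX)

  Φ-over : ∀ {X Y A C} {u : E.Hom X Y} {g : B.Hom A C} →
           u F.over g → Φ.F₁ u F'.over φ.F₁ g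
  Φ-over {X} {Y} {u = u} (refl , refl , refl) = comm₀ X , comm₀ Y , comm₁ u

  Φ-vert : ∀ {X Y A} {u : E.Hom X Y} → F.Vert A u → F'.Vert (φ.F₀ A) (Φ.F₁ u)
  Φ-vert vu = O'.over-resp (Φ-over vu) φ.F-id

  Φ-cart : ∀ {X Y A C} {u : E.Hom X Y} {g : B.Hom A C} →
           F.CartOver g u → F'.CartOver (φ.F₁ g) (Φ.F₁ u)
  Φ-cart {u = u} (uo , cartesian) = Φ-over uo , pres-cartesian u cartesian

  fiber-full : ∀ A {X Y} → P.F₀ X ≡ A → P.F₀ Y ≡ A →
    (v : Hom (Φ.F₀ X) (Φ.F₀ Y)) → F'.Vert (φ.F₀ A) v →
    Σ[ u ∈ E.Hom X Y ] F.Vert A u × (Φ.F₁ u ≡ v)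
  fiber-full A = proj₁ (equivalence A)

  fiber-faithful : ∀ A {X Y} (u u' : E.Hom X Y) → F.Vert A u → F.Vert A u' →
    Φ.F₁ u ≡ Φ.F₁ u' → u ≡ u'
  fiber-faithful A = proj₁ (proj₂ (equivalence A))

  Φ-full-over : ∀ {X Y A C} (g : B.Hom A C) → P.F₀ X ≡ A → P.F₀ Y ≡ C →
    (v : Hom (Φ.F₀ X) (Φ.F₀ Y)) → v F'.over φ.F₁ g →
    Σ[ u ∈ E.Hom X Y ] (u F.over g) × (Φ.F₁ u ≡ v)
  Φ-full-over g pX pY v vo
    with O.cartesian-lift fibration g _ pY
  ... | D , d , dc
    with O'.cartesian-factor (Φ-cart dc) v B'.id (O'.over-resp vo (sym (B'.identityʳ _)))
  ... | m , (vm , dm) , _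
    with fiber-full _ pX (O.over-dom (proj₁ dc)) m vm
  ... | m₀ , vm₀ , Φm₀ =
    d E.∘ m₀ , O.over∘vert (proj₁ dc) vm₀ ,
    trans (Φ.F-∘ d m₀) (trans (cong (Φ.F₁ d ∘_) Φm₀) dm)

  Φ-faithful-over : ∀ {X Y A C} {g : B.Hom A C} {u u' : E.Hom X Y} →
    u F.over g → u' F.over g → Φ.F₁ u ≡ Φ.F₁ u' → u ≡ u'
  Φ-faithful-over {g = g} {u} {u'} uo u'o Φu≡Φu'
    with O.cartesian-lift fibration g _ (O.over-cod uo)
  ... | D , d , dc
    with O.cartesian-factor dc u B.id (O.over-resp uo (sym (B.identityʳ g)))
       | O.cartesian-factor dc u' B.id (O.over-resp u'o (sym (B.identityʳ g)))
  ... | a , (va , da) , _ | a' , (va' , da') , _ =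
    trans (sym da) (trans (cong (d E.∘_) a≡a') da')
    where
    Φd∘Φa≡Φd∘Φa' : Φ.F₁ d ∘ Φ.F₁ a ≡ Φ.F₁ d ∘ Φ.F₁ a'
    Φd∘Φa≡Φd∘Φa' = begin
      Φ.F₁ d ∘ Φ.F₁ a   ≡˘⟨ Φ.F-∘ d a ⟩
      Φ.F₁ (d E.∘ a)    ≡⟨ cong Φ.F₁ da ⟩
      Φ.F₁ u            ≡⟨ Φu≡Φu' ⟩
      Φ.F₁ u'           ≡˘⟨ cong Φ.F₁ da' ⟩
      Φ.F₁ (d E.∘ a')   ≡⟨ Φ.F-∘ d a' ⟩
      Φ.F₁ d ∘ Φ.F₁ a'  ∎
      where open ≡-Reasoning
    a≡a' : a ≡ a'
    a≡a' = fiber-faithful _ a a' va va'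
             (O'.cartesian-cancel (Φ-cart dc) (Φ-vert va) (Φ-vert va') Φd∘Φa≡Φd∘Φa')

  record Replacement (A : B.Obj) (X' : Obj) : Set (ob ⊔ oe ⊔ ob' ⊔ ℓb' ⊔ ℓe') where
    field
      obj : E.Obj
      obj-over : P.F₀ obj ≡ A
      iso : O'.VerticalIso (φ.F₀ A) (Φ.F₀ obj) X'

  open Replacement

  replace : ∀ A X' → P'.F₀ X' ≡ φ.F₀ A → Replacement A X'
  replace A X' pX' with proj₂ (proj₂ (equivalence A)) X' pX'
  ... | X , pX , i , j , vi , vj , ij , ji = record
    { obj = X ; obj-over = pX
    ; iso = record { to = i ; from = j ; to-vert = vi ; from-vert = vj ; isoˡ = ji ; isoʳ = ij } }

  module _ {A X'} (r : Replacement A X') where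

    outof : ∀ {Y} → E.Hom (obj r) Y → Hom X' (Φ.F₀ Y)
    outof u = Φ.F₁ u ∘ from (iso r)

    into : ∀ {Y} → E.Hom Y (obj r) → Hom (Φ.F₀ Y) X'
    into u = to (iso r) ∘ Φ.F₁ u

    outof-∘ : ∀ {Y Z} (a : E.Hom Y Z) (u : E.Hom (obj r) Y) →
              Φ.F₁ a ∘ outof u ≡ outof (a E.∘ u)
    outof-∘ a u = trans (sym (assoc _ _ _)) (cong (_∘ from (iso r)) (sym (Φ.F-∘ a u)))

    into-∘ : ∀ {Y Z} (u : E.Hom Y (obj r)) (a : E.Hom Z Y) →
             into u ∘ Φ.F₁ a ≡ into (u E.∘ a)
    into-∘ u a = trans (assoc _ _ _) (cong (to (iso r) ∘_) (sym (Φ.F-∘ u a)))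

    outof-vert : ∀ {Y} {u : E.Hom (obj r) Y} → F.Vert A u → F'.Vert (φ.F₀ A) (outof u)
    outof-vert vu = O'.vert-∘ (from-vert (iso r)) (Φ-vert vu)

    into-vert : ∀ {Y} {u : E.Hom Y (obj r)} → F.Vert A u → F'.Vert (φ.F₀ A) (into u)
    into-vert vu = O'.vert-∘ (Φ-vert vu) (to-vert (iso r))

    outof-injective : ∀ {Y C} {g : B.Hom A C} {u u' : E.Hom (obj r) Y} →
      u F.over g → u' F.over g → outof u ≡ outof u' → u ≡ u'
    outof-injective uo u'o e = Φ-faithful-over uo u'o
      (trans (sym (cancelʳ (isoˡ (iso r)))) (trans (cong (_∘ to (iso r)) e) (cancelʳ (isoˡ (iso r)))))

    into-injective : ∀ {Y C} {g : B.Hom C A} {u u' : E.Hom Y (obj r)} →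
      u F.over g → u' F.over g → into u ≡ into u' → u ≡ u'
    into-injective uo u'o e = Φ-faithful-over uo u'o
      (trans (sym (cancelˡ (isoˡ (iso r)))) (trans (cong (from (iso r) ∘_) e) (cancelˡ (isoˡ (iso r)))))

    outof-preimage : ∀ {Y C} (g : B.Hom A C) → P.F₀ Y ≡ C →
      (v : Hom X' (Φ.F₀ Y)) → v F'.over φ.F₁ g →
      Σ[ u ∈ E.Hom (obj r) Y ] (u F.over g) × (outof u ≡ v)
    outof-preimage g pY v vo
      with Φ-full-over g (obj-over r) pY (v ∘ to (iso r)) (O'.over∘vert vo (to-vert (iso r)))
    ... | u , uo , Φu = u , uo , trans (cong (_∘ from (iso r)) Φu) (cancelʳ (isoʳ (iso r)))

    into-preimage : ∀ {Y C} (g : B.Hom C A) → P.F₀ Y ≡ C →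
      (v : Hom (Φ.F₀ Y) X') → v F'.over φ.F₁ g →
      Σ[ u ∈ E.Hom Y (obj r) ] (u F.over g) × (into u ≡ v)
    into-preimage g pY v vo
      with Φ-full-over g pY (obj-over r) (from (iso r) ∘ v) (O'.vert∘over (from-vert (iso r)) vo)
    ... | u , uo , Φu = u , uo , trans (cong (to (iso r) ∘_) Φu) (cancelˡ (isoʳ (iso r)))

    outof-preimageᵛ : ∀ {Y} → P.F₀ Y ≡ A → (v : Hom X' (Φ.F₀ Y)) → F'.Vert (φ.F₀ A) v →
      Σ[ u ∈ E.Hom (obj r) Y ] F.Vert A u × (outof u ≡ v)
    outof-preimageᵛ pY v vv = outof-preimage B.id pY v (O'.over-resp vv (sym φ.F-id))

    into-preimageᵛ : ∀ {Y} → P.F₀ Y ≡ A → (v : Hom (Φ.F₀ Y) X') → F'.Vert (φ.F₀ A) v →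
      Σ[ u ∈ E.Hom Y (obj r) ] F.Vert A u × (into u ≡ v)
    into-preimageᵛ pY v vv = into-preimage B.id pY v (O'.over-resp vv (sym φ.F-id))

    outof-resp-∘ : ∀ {Y Z} {a : E.Hom Y Z} {u : E.Hom (obj r) Y} {w} →
      a E.∘ u ≡ w → Φ.F₁ a ∘ outof u ≡ outof w
    outof-resp-∘ {a = a} {u} e = trans (outof-∘ a u) (cong outof e)

    into-resp-∘ : ∀ {Y Z} {u : E.Hom Y (obj r)} {a : E.Hom Z Y} {w} →
      u E.∘ a ≡ w → into u ∘ Φ.F₁ a ≡ into w
    into-resp-∘ {u = u} {a} e = trans (into-∘ u a) (cong into e)

    outof-reflect-∘ : ∀ {Y Z C} {g : B.Hom A C} {a : E.Hom Y Z} {u : E.Hom (obj r) Y} {w} →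
      (a E.∘ u) F.over g → w F.over g → Φ.F₁ a ∘ outof u ≡ outof w → a E.∘ u ≡ w
    outof-reflect-∘ {a = a} {u} auo wo e = outof-injective auo wo (trans (sym (outof-∘ a u)) e)

    into-reflect-∘ : ∀ {Y Z C} {g : B.Hom C A} {u : E.Hom Y (obj r)} {a : E.Hom Z Y} {w} →
      (u E.∘ a) F.over g → w F.over g → into u ∘ Φ.F₁ a ≡ into w → u E.∘ a ≡ w
    into-reflect-∘ {u = u} {a} uao wo e = into-injective uao wo (trans (sym (into-∘ u a)) e)

    outof-Unique : ∀ {Y ℓ ℓ'} → P.F₀ Y ≡ A →
      {R : E.Hom (obj r) Y → Set ℓ} {R' : Hom X' (Φ.F₀ Y) → Set ℓ'} →
      (∀ {u} → F.Vert A u → R u → R' (outof u)) →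
      (∀ {u} → F.Vert A u → R' (outof u) → R u) →
      Unique (λ u → F.Vert A u × R u) → Unique (λ v → F'.Vert (φ.F₀ A) v × R' v)
    outof-Unique pY {R' = R'} forward backward =
      Unique-map outof (λ v (vv , _) → proj₁ (preimage v vv))
        (λ (vu , Ru) → outof-vert vu , forward vu Ru)
        (λ {v} (vv , R'v) → let (_ , vu , ou) = preimage v vv
                            in vu , backward vu (subst R' (sym ou) R'v))
        (λ {v} (vv , _) → proj₂ (proj₂ (preimage v vv)))
      where preimage = outof-preimageᵛ pY

    into-Unique : ∀ {Y ℓ ℓ'} → P.F₀ Y ≡ A →
      {R : E.Hom Y (obj r) → Set ℓ} {R' : Hom (Φ.F₀ Y) X' → Set ℓ'} →
      (∀ {u} → F.Vert A u → R u → R' (into u)) →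
      (∀ {u} → F.Vert A u → R' (into u) → R u) →
      Unique (λ u → F.Vert A u × R u) → Unique (λ v → F'.Vert (φ.F₀ A) v × R' v)
    into-Unique pY {R' = R'} forward backward =
      Unique-map into (λ v (vv , _) → proj₁ (preimage v vv))
        (λ (vu , Ru) → into-vert vu , forward vu Ru)
        (λ {v} (vv , R'v) → let (_ , vu , iu) = preimage v vv
                            in vu , backward vu (subst R' (sym iu) R'v))
        (λ {v} (vv , _) → proj₂ (proj₂ (preimage v vv)))
      where preimage = into-preimageᵛ pY

  outof-square : ∀ {A₁ A₂ X₁ X₂} (r₁ : Replacement A₁ X₁) (r₂ : Replacement A₂ X₂)
    {e : E.Hom (obj r₂) (obj r₁)} {e' : Hom X₂ X₁} →
    Φ.F₁ e ∘ from (iso r₂) ≡ from (iso r₁) ∘ e' →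
    ∀ {Y} (a : E.Hom (obj r₁) Y) → outof r₂ (a E.∘ e) ≡ outof r₁ a ∘ e'
  outof-square r₁ r₂ {e} square a =
    trans (cong (_∘ from (iso r₂)) (Φ.F-∘ a e)) (trans (pullʳ square) (sym (assoc _ _ _)))

  pres-terminal : ∀ A T → F.IsTerminalIn A T → F'.IsTerminalIn (φ.F₀ A) (Φ.F₀ T)
  pres-terminal A T (pT , universal) = Φ-obj pT , λ X' pX' →
    let r = replace A X' pX'
        preimage = outof-preimageᵛ r pT
    in Unique-map (outof r) (λ v vv → proj₁ (preimage v vv)) (outof-vert r)
         (λ {v} vv → proj₁ (proj₂ (preimage v vv))) (λ {v} vv → proj₂ (proj₂ (preimage v vv)))
         (universal (obj r) (obj-over r))

  pres-initial : ∀ A I → F.IsInitialIn A I → F'.IsInitialIn (φ.F₀ A) (Φ.F₀ I)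
  pres-initial A I (pI , universal) = Φ-obj pI , λ X' pX' →
    let r = replace A X' pX'
        preimage = into-preimageᵛ r pI
    in Unique-map (into r) (λ v vv → proj₁ (preimage v vv)) (into-vert r)
         (λ {v} vv → proj₁ (proj₂ (preimage v vv))) (λ {v} vv → proj₂ (proj₂ (preimage v vv)))
         (universal (obj r) (obj-over r))

  pres-product : ∀ A {Q Q₁ Q₂} (π₁ : E.Hom Q Q₁) (π₂ : E.Hom Q Q₂) →
    F.IsProductIn A π₁ π₂ → F'.IsProductIn (φ.F₀ A) (Φ.F₁ π₁) (Φ.F₁ π₂)
  pres-product A π₁ π₂ (vπ₁ , vπ₂ , universal) = Φ-vert vπ₁ , Φ-vert vπ₂ , λ x₁ x₂ vx₁ vx₂ →
    let r = replace A _ (O'.over-dom vx₁)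
        (w₁ , vw₁ , ow₁) = outof-preimageᵛ r (O.over-cod vπ₁) x₁ vx₁
        (w₂ , vw₂ , ow₂) = outof-preimageᵛ r (O.over-cod vπ₂) x₂ vx₂
    in outof-Unique r (O.over-dom vπ₁)
         (λ _ (e₁ , e₂) → trans (outof-resp-∘ r e₁) ow₁ , trans (outof-resp-∘ r e₂) ow₂)
         (λ vu (e₁ , e₂) → outof-reflect-∘ r (O.vert-∘ vu vπ₁) vw₁ (trans e₁ (sym ow₁)) ,
                           outof-reflect-∘ r (O.vert-∘ vu vπ₂) vw₂ (trans e₂ (sym ow₂)))
         (universal w₁ w₂ vw₁ vw₂)

  pres-coproduct : ∀ A {Q Q₁ Q₂} (ι₁ : E.Hom Q₁ Q) (ι₂ : E.Hom Q₂ Q) →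
    F.IsCoproductIn A ι₁ ι₂ → F'.IsCoproductIn (φ.F₀ A) (Φ.F₁ ι₁) (Φ.F₁ ι₂)
  pres-coproduct A ι₁ ι₂ (vι₁ , vι₂ , universal) = Φ-vert vι₁ , Φ-vert vι₂ , λ x₁ x₂ vx₁ vx₂ →
    let r = replace A _ (O'.over-cod vx₁)
        (w₁ , vw₁ , iw₁) = into-preimageᵛ r (O.over-dom vι₁) x₁ vx₁
        (w₂ , vw₂ , iw₂) = into-preimageᵛ r (O.over-dom vι₂) x₂ vx₂
    in into-Unique r (O.over-cod vι₁)
         (λ _ (e₁ , e₂) → trans (into-resp-∘ r e₁) iw₁ , trans (into-resp-∘ r e₂) iw₂)
         (λ vu (e₁ , e₂) → into-reflect-∘ r (O.vert-∘ vι₁ vu) vw₁ (trans e₁ (sym iw₁)) ,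
                           into-reflect-∘ r (O.vert-∘ vι₂ vu) vw₂ (trans e₂ (sym iw₂)))
         (universal w₁ w₂ vw₁ vw₂)

  transfer-exponential-universality :
    ∀ {A Ex EY Y Z X' XY'} {π₁ : E.Hom EY Ex} {π₂ : E.Hom EY Y} {ev : E.Hom EY Z}
      (r₁ : Replacement A X') (r₂ : Replacement A XY')
      {q₁ : E.Hom (obj r₂) (obj r₁)} {q₂ : E.Hom (obj r₂) Y}
      {p₁ : Hom XY' X'} {p₂ : Hom XY' (Φ.F₀ Y)}
      {f₀ : E.Hom (obj r₂) Z} {f : Hom XY' (Φ.F₀ Z)} →
    F.Vert A π₁ → F.Vert A π₂ → F.Vert A ev → F.Vert A q₁ → F.Vert A q₂ → F.Vert A f₀ →
    Φ.F₁ q₁ ∘ from (iso r₂) ≡ from (iso r₁) ∘ p₁ → outof r₂ q₂ ≡ p₂ → outof r₂ f₀ ≡ f →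
    Unique (λ g → F.Vert A g ×
      (∀ h → F.Vert A h → π₁ E.∘ h ≡ g E.∘ q₁ → π₂ E.∘ h ≡ q₂ → ev E.∘ h ≡ f₀)) →
    Unique (λ g → F'.Vert (φ.F₀ A) g ×
      (∀ h → F'.Vert (φ.F₀ A) h → Φ.F₁ π₁ ∘ h ≡ g ∘ p₁ → Φ.F₁ π₂ ∘ h ≡ p₂ →
         Φ.F₁ ev ∘ h ≡ f))
  transfer-exponential-universality {π₁ = π₁} {π₂} {ev} r₁ r₂
    vπ₁ vπ₂ vev vq₁ vq₂ vf₀ q₁-square q₂-eq f₀-eq =
    outof-Unique r₁ (O.over-cod vπ₁)
      (λ vg universal h vh e₁ e₂ →
        let (h₀ , vh₀ , h₀-eq) = outof-preimageᵛ r₂ (O.over-dom vπ₁) h vh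
            b₁ = outof-reflect-∘ r₂ (O.vert-∘ vh₀ vπ₁) (O.vert-∘ vq₁ vg)
                   (trans (cong (Φ.F₁ π₁ ∘_) h₀-eq) (trans e₁ (sym (square _))))
            b₂ = outof-reflect-∘ r₂ (O.vert-∘ vh₀ vπ₂) vq₂
                   (trans (cong (Φ.F₁ π₂ ∘_) h₀-eq) (trans e₂ (sym q₂-eq)))
        in trans (cong (Φ.F₁ ev ∘_) (sym h₀-eq)) (trans (outof-resp-∘ r₂ (universal h₀ vh₀ b₁ b₂)) f₀-eq))
      (λ vg universal h₀ vh₀ b₁ b₂ →
        outof-reflect-∘ r₂ (O.vert-∘ vh₀ vev) vf₀
          (trans (universal (outof r₂ h₀) (outof-vert r₂ vh₀)
                    (trans (outof-resp-∘ r₂ b₁) (square _)) (trans (outof-resp-∘ r₂ b₂) q₂-eq))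
                 (sym f₀-eq)))
    where square = outof-square r₁ r₂ q₁-square

  transfer-pi-universality :
    ∀ {A C X R Q S' Q''} {f : B.Hom A C} {c : E.Hom X R} {ε : E.Hom X Q}
      (rQ : Replacement C Q'') (rS : Replacement A S')
      {d : E.Hom (obj rS) (obj rQ)} {c' : Hom S' Q''}
      {p₀ : E.Hom (obj rS) Q} {p : Hom S' (Φ.F₀ Q)} →
    c F.over f → F.Vert A ε → d F.over f → F.Vert A p₀ →
    Φ.F₁ d ∘ from (iso rS) ≡ from (iso rQ) ∘ c' → outof rS p₀ ≡ p →
    Unique (λ p̃ → F.Vert C p̃ ×
      (∀ u → F.Vert A u → c E.∘ u ≡ p̃ E.∘ d → ε E.∘ u ≡ p₀)) →
    Unique (λ p̃ → F'.Vert (φ.F₀ C) p̃ ×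
      (∀ u → F'.Vert (φ.F₀ A) u → Φ.F₁ c ∘ u ≡ p̃ ∘ c' → Φ.F₁ ε ∘ u ≡ p))
  transfer-pi-universality {c = c} {ε} rQ rS co vε dₒ vp₀ d-square p₀-eq =
    outof-Unique rQ (O.over-cod co)
      (λ vp̃ universal u vu e →
        let (u₀ , vu₀ , u₀-eq) = outof-preimageᵛ rS (O.over-dom co) u vu
            b = outof-reflect-∘ rS (O.over∘vert co vu₀) (O.vert∘over vp̃ dₒ)
                  (trans (cong (Φ.F₁ c ∘_) u₀-eq) (trans e (sym (square _))))
        in trans (cong (Φ.F₁ ε ∘_) (sym u₀-eq)) (trans (outof-resp-∘ rS (universal u₀ vu₀ b)) p₀-eq))
      (λ vp̃ universal u₀ vu₀ e →
        outof-reflect-∘ rS (O.vert-∘ vu₀ vε) vp₀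
          (trans (universal (outof rS u₀) (outof-vert rS vu₀) (trans (outof-resp-∘ rS e) (square _)))
                 (sym p₀-eq)))
    where square = outof-square rQ rS d-square

  pres-exponential :
    (∀ A Q₁ Q₂ → P.F₀ Q₁ ≡ A → P.F₀ Q₂ ≡ A →
       Σ[ Q ∈ E.Obj ] Σ[ π₁ ∈ E.Hom Q Q₁ ] Σ[ π₂ ∈ E.Hom Q Q₂ ] F.IsProductIn A π₁ π₂) →
    ∀ A {Ex EY Y Z} (π₁ : E.Hom EY Ex) (π₂ : E.Hom EY Y) (ev : E.Hom EY Z) →
    F.IsExponentialIn A π₁ π₂ ev →
    F'.IsExponentialIn (φ.F₀ A) (Φ.F₁ π₁) (Φ.F₁ π₂) (Φ.F₁ ev)
  pres-exponential products A π₁ π₂ ev (prod , vev , universal) =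
    pres-product A π₁ π₂ prod , Φ-vert vev , λ p₁ p₂ pprod f vf →
      let (vπ₁ , vπ₂ , _) = prod
          r₁ = replace A _ (O'.over-cod (proj₁ pprod))
          (XY₀ , q₁ , q₂ , qprod) = products A (obj r₁) _ (obj-over r₁) (O.over-cod vπ₂)
          (vq₁ , vq₂ , _) = qprod
          (κ , q₁-square , q₂-eq) = O'.product-apexes-iso pprod (pres-product A q₁ q₂ qprod) (iso r₁)
          r₂ = record { obj = XY₀ ; obj-over = O.over-dom vq₁ ; iso = κ }
          (f₀ , vf₀ , f₀-eq) = outof-preimageᵛ r₂ (O.over-cod vev) f vf
      in transfer-exponential-universality r₁ r₂ vπ₁ vπ₂ vev vq₁ vq₂ vf₀ q₁-square q₂-eq f₀-eq
           (universal q₁ q₂ qprod f₀ vf₀)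

  pres-pi : ∀ {A C} (f : B.Hom A C) {X R Q} (c : E.Hom X R) (ε : E.Hom X Q) →
    F.IsPiDiagram f c ε → F'.IsPiDiagram (φ.F₁ f) (Φ.F₁ c) (Φ.F₁ ε)
  pres-pi {C = C} f c ε (cc , vε , universal) = Φ-cart cc , Φ-vert vε , λ c' c'c p vp →
    let rQ = replace C _ (O'.over-cod (proj₁ c'c))
        (S₀ , d , dc) = O.cartesian-lift fibration f (obj rQ) (obj-over rQ)
        (κ , d-square) = O'.cartesian-domains-iso c'c (Φ-cart dc) (iso rQ)
        rS = record { obj = S₀ ; obj-over = O.over-dom (proj₁ dc) ; iso = κ }
        (p₀ , vp₀ , p₀-eq) = outof-preimageᵛ rS (O.over-cod vε) p vp
    in transfer-pi-universality rQ rS (proj₁ cc) vε (proj₁ dc) vp₀ d-square p₀-eq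
         (universal d dc p₀ vp₀)

  pres-cocartesian : F'.IsFibration → ∀ {Q Q'} (q : E.Hom Q Q') →
    F.IsCocartesian q → F'.IsCocartesian (Φ.F₁ q)
  pres-cocartesian fibration' {Q' = Q'} q cocartesian =
    O'.cocartesian-if-vertically-universal fibration' (Φ-over (O.over-self q)) λ r ro →
      let rZ = replace (P.F₀ Q') _ (O'.over-cod ro)
          (r₀ , r₀o , r₀-eq) = into-preimage rZ (P.F₁ q) refl r ro
      in into-Unique rZ refl
           (λ _ e → trans (into-resp-∘ rZ e) r₀-eq)
           (λ vu e → into-reflect-∘ rZ (O.over-resp (O.over-∘ (O.over-self q) vu) (B.identityˡ _))
                       r₀o (trans e (sym r₀-eq)))
           (cocartesian r₀ B.id (O.over-resp r₀o (sym (B.identityˡ _))))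

proposition4p3p7 : ∀ {ob ℓb oe ℓe ob' ℓb' oe' ℓe' : Level}
    {𝔹 : Category ob ℓb} {𝔼 : Category oe ℓe} (C : Functor 𝔼 𝔹)
    {𝔹' : Category ob' ℓb'} {𝔼' : Category oe' ℓe'} (C' : Functor 𝔼' 𝔹')
    (φ : Functor 𝔹 𝔹') (Φ : Functor 𝔼 𝔼') →
    FibDefs.IsHEqFibration C → FibDefs.IsHEqFibration C' →
    MorDefs.IsFibrationMorphism C C' φ Φ →
    MorDefs.IsFiberwiseEquivalence C C' φ Φ →
    MorDefs.PreservesFiniteProducts C C' φ Φ →
    MorDefs.IsHEqMorphism C C' φ Φ
proposition4p3p7 C C' φ Φ H H' morphism equivalence base-products = record
  { fibration-morphism = morphism
  ; pres-terminal = pres-terminal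
  ; pres-product = pres-product
  ; pres-initial = pres-initial
  ; pres-coproduct = pres-coproduct
  ; pres-exponential = pres-exponential (FibDefs.StableFiberStructure.products H.fibers)
  ; pres-pi = λ _ π₂ _ c ε → pres-pi π₂ c ε
  ; pres-cocart-proj = λ _ _ _ q _ → pres-cocartesian H'.fibration q
  ; pres-base-products = base-products
  ; pres-cocart-diag = λ _ _ _ _ _ _ q _ _ → pres-cocartesian H'.fibration q
  }
  where
  module H = FibDefs.IsHEqFibration H
  module H' = FibDefs.IsHEqFibration H'
  open FiberwiseEquivalence C C' φ Φ H.fibration morphism equivalence
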